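{- Let $r \ge 2$ and $k \ge 2$ be integers, and let $p$ be the largest prime with $p \le k$. Then $$w(r,k) > p\left(w\left(r - \left\lceil \tfrac{r}{p} \right\rceil, k\right) - 1\right).$$
   Context: For positive integers $r,k$, the van der Waerden number $w(r,k)$ is the least positive integer $N$ such that every coloring of $\{1,2,\dots,N\}$ with $r$ colors contains a monochromatic arithmetic progression of length $k$ (i.e. $x_1<\dots<x_k$ with constant difference $x_{i+1}-x_i=d\ge 1$, all of the same color). In particular $w(1,k)=k$. -}

module Defs where

open import Data.Nat using (ℕ; zero; suc; _+_; _*_; _∸_; _≤_; _<_)
open import Data.Nat.Primality using (Prime)
open import Data.Fin using (Fin)
open import Data.Product using (Σ; _×_; ∃-syntax)
open import Relation.Binary.PropositionalEquality using (_≡_)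

-- An r-colouring of {1,…,N}; only its values on 1..N are relevant.
Colouring : ℕ → Set
Colouring r = ℕ → Fin r

HasMonoAP : (r k N : ℕ) → Colouring r → Set
HasMonoAP r k N c =
  ∃[ a ] ∃[ d ] (1 ≤ a × 1 ≤ d × a + (k ∸ 1) * d ≤ N ×
    ((i : ℕ) → i < k → c (a + i * d) ≡ c a))

VdWProp : (r k N : ℕ) → Set
VdWProp r k N = (c : Colouring r) → HasMonoAP r k N c

IsVdW : (r k N : ℕ) → Set
IsVdW r k N = 1 ≤ N × VdWProp r k N × ((M : ℕ) → 1 ≤ M → VdWProp r k M → N ≤ M)

IsLargestPrimeLE : (k p : ℕ) → Set
IsLargestPrimeLE k p = Prime p × p ≤ k × ((q : ℕ) → Prime q → q ≤ k → q ≤ p)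

open import Data.Nat.DivMod using (_/_)
open import Data.Nat using (NonZero)
ceilDiv : (r p : ℕ) → .{{NonZero p}} → ℕ
ceilDiv r p = (r + p ∸ 1) / p

-- Given an (r − s)-colouring χ of {1,…,N} with s = ⌈r/p⌉, colour the point
-- pq + j + 1 (0 ≤ j < p) of {1,…,pN} by χ(q + 1) pushed past the gap
-- [js, js + s) of colours.  A monochromatic k-term progression with
-- difference d prime to p has, among its first p ≤ k terms, one in every
-- residue class mod p — including the class j whose gap contains its colour,
-- which is impossible.  So p ∣ d, and the progression projects onto one of χ.
-- Hence w(r,k) ≤ pN forces w(r − ⌈r/p⌉, k) ≤ N.
module Submission where

open import Defs
open import Data.Nat
  using (ℕ; zero; suc; _+_; _*_; _∸_; _≤_; _<_; z≤n; s≤s; s≤s⁻¹; NonZero; >-nonZero; >-nonZero⁻¹; _<?_; _%_; _/_)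
open import Data.Nat.Properties
open import Data.Nat.DivMod
open import Data.Nat.Divisibility using (_∣_; _∣?_; divides; divides-refl; ∣m+n∣m⇒∣n; ∣⇒≤)
open import Data.Nat.Primality using (Prime; euclidsLemma)
open import Data.Fin using (Fin; toℕ; fromℕ<; punchOut)
open import Data.Fin.Properties
  using (toℕ-fromℕ<; toℕ-injective; toℕ<n; punchOut-injective; injective⇒≤; any?)
  renaming (_≟_ to _≟ᶠ_)
open import Data.Product using (_×_; _,_; ∃-syntax)
open import Data.Sum using (inj₁; inj₂)
open import Function.Definitions using (Injective; StrictlySurjective)
open import Relation.Nullary using (¬_; yes; no; contradiction)
open import Relation.Binary.Definitions using (tri<; tri≈; tri>)
open import Relation.Binary.PropositionalEquality

injective⇒strictlySurjective : ∀ {n} {f : Fin n → Fin n} →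
  Injective _≡_ _≡_ f → StrictlySurjective _≡_ f
injective⇒strictlySurjective {suc n} {f} f-inj j with any? (λ i → f i ≟ᶠ j)
... | yes hit = hit
... | no miss = contradiction (injective⇒≤ g-inj) 1+n≰n
  where
  j≢f : ∀ i → j ≢ f i
  j≢f i j≡fi = miss (i , sym j≡fi)

  g : Fin (suc n) → Fin n
  g i = punchOut (j≢f i)

  g-inj : Injective _≡_ _≡_ g
  g-inj eq = f-inj (punchOut-injective (j≢f _) (j≢f _) eq)

m%n≡[m+k]%n⇒n∣k : ∀ m k n .{{_ : NonZero n}} → m % n ≡ (m + k) % n → n ∣ k
m%n≡[m+k]%n⇒n∣k m k n eq = ∣m+n∣m⇒∣n (divides ((m + k) / n) quotients) (divides-refl (m / n))
  where
  open ≡-Reasoning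
  quotients : m / n * n + k ≡ (m + k) / n * n
  quotients = +-cancelˡ-≡ (m % n) _ _ (begin
    m % n + (m / n * n + k)        ≡⟨ +-assoc (m % n) _ k ⟨
    m % n + m / n * n + k          ≡⟨ cong (_+ k) (m≡m%n+[m/n]*n m n) ⟨
    m + k                          ≡⟨ m≡m%n+[m/n]*n (m + k) n ⟩
    (m + k) % n + (m + k) / n * n  ≡⟨ cong (_+ (m + k) / n * n) eq ⟨
    m % n + (m + k) / n * n        ∎)

[m+kn]/n≡m/n+k : ∀ m k n .{{_ : NonZero n}} → (m + k * n) / n ≡ m / n + k
[m+kn]/n≡m/n+k m k n = trans (+-distrib-/-∣ʳ m (divides-refl k)) (cong (m / n +_) (m*n/n≡m k n))

module _ {p} .{{_ : NonZero p}} (p-prime : Prime p) {d} (p∤d : ¬ p ∣ d) (b : ℕ) where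

  private
    residue-distinct : ∀ {i j} → i < j → j < p → (b + i * d) % p ≢ (b + j * d) % p
    residue-distinct {i} {j} i<j j<p eq with euclidsLemma (j ∸ i) d p-prime p∣[j∸i]d
      where
      shift : b + j * d ≡ b + i * d + (j ∸ i) * d
      shift = begin
        b + j * d                    ≡⟨ cong (λ t → b + t * d) (m+[n∸m]≡n (<⇒≤ i<j)) ⟨
        b + (i + (j ∸ i)) * d        ≡⟨ cong (b +_) (*-distribʳ-+ d i (j ∸ i)) ⟩
        b + (i * d + (j ∸ i) * d)    ≡⟨ +-assoc b (i * d) _ ⟨
        b + i * d + (j ∸ i) * d      ∎
        where open ≡-Reasoning
      p∣[j∸i]d : p ∣ (j ∸ i) * d
      p∣[j∸i]d = m%n≡[m+k]%n⇒n∣k (b + i * d) _ p (trans eq (cong (_% p) shift))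
    ... | inj₂ p∣d = p∤d p∣d
    ... | inj₁ p∣j∸i = <⇒≱ (≤-<-trans (m∸n≤m j i) j<p) (∣⇒≤ {{>-nonZero (m<n⇒0<n∸m i<j)}} p∣j∸i)

  residue-injective : ∀ {i j} → i < p → j < p → (b + i * d) % p ≡ (b + j * d) % p → i ≡ j
  residue-injective {i} {j} i<p j<p eq with <-cmp i j
  ... | tri< i<j _ _ = contradiction eq (residue-distinct i<j j<p)
  ... | tri≈ _ i≡j _ = i≡j
  ... | tri> _ _ j<i = contradiction (sym eq) (residue-distinct j<i i<p)

  residues-cover : ∀ {j} → j < p → ∃[ i ] (i < p × (b + i * d) % p ≡ j)
  residues-cover j<p with injective⇒strictlySurjective residue-inj (fromℕ< j<p)
    where
    residue : Fin p → Fin p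
    residue i = fromℕ< (m%n<n (b + toℕ i * d) p)
    residue-inj : Injective _≡_ _≡_ residue
    residue-inj eq = toℕ-injective (residue-injective (toℕ<n _) (toℕ<n _)
      (trans (sym (toℕ-fromℕ< _)) (trans (cong toℕ eq) (toℕ-fromℕ< _))))
  ... | i , eq = toℕ i , toℕ<n i , trans (sym (toℕ-fromℕ< _)) (trans (cong toℕ eq) (toℕ-fromℕ< j<p))

skip : (s j v : ℕ) → ℕ
skip s j v with v <? j * s
... | yes _ = v
... | no _  = v + s

skip-injective : ∀ s j {v w} → skip s j v ≡ skip s j w → v ≡ w
skip-injective s j {v} {w} eq with v <? j * s | w <? j * s
... | yes _   | yes _   = eq
... | yes v<  | no w≮   = contradiction (subst (j * s ≤_) (sym eq) (≤-trans (≮⇒≥ w≮) (m≤m+n w s))) (<⇒≱ v<)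
... | no v≮   | yes w<  = contradiction (subst (j * s ≤_) eq (≤-trans (≮⇒≥ v≮) (m≤m+n v s))) (<⇒≱ w<)
... | no _    | no _    = +-cancelʳ-≡ s v w eq

skip-< : ∀ {s r} j {v} → s ≤ r → v < r ∸ s → skip s j v < r
skip-< {s} {r} j {v} s≤r v<r∸s with v <? j * s
... | yes _ = ≤-trans v<r∸s (m∸n≤m r s)
... | no _  = subst (v + s <_) (m∸n+n≡m s≤r) (+-monoˡ-< s v<r∸s)

skip-avoids : ∀ s .{{_ : NonZero s}} v w → skip s (v / s) w ≢ v
skip-avoids s v w with w <? v / s * s
... | yes w< = <⇒≢ (≤-trans w< (m/n*n≤m v s))
... | no w≮  = >⇒≢ (begin-strict
  v                    ≡⟨ m≡m%n+[m/n]*n v s ⟩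
  v % s + v / s * s    ≡⟨ +-comm (v % s) _ ⟩
  v / s * s + v % s    <⟨ +-mono-≤-< (≮⇒≥ w≮) (m%n<n v s) ⟩
  w + s                ∎)
  where open ≤-Reasoning

private
  ceilDiv-numerator : ∀ r q → r + suc q ∸ 1 ≡ r + q
  ceilDiv-numerator r q = cong (_∸ 1) (+-suc r q)

ceilDiv>0 : ∀ r p .{{_ : NonZero p}} → 1 ≤ r → 0 < ceilDiv r p
ceilDiv>0 r (suc q) 1≤r =
  m≥n⇒m/n>0 (subst (suc q ≤_) (sym (ceilDiv-numerator r q)) (+-monoˡ-≤ q 1≤r))

ceilDiv≤ : ∀ r p .{{_ : NonZero p}} → ceilDiv r p ≤ r
ceilDiv≤ r p@(suc q) = s≤s⁻¹ (m<n*o⇒m/o<n (begin-strict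
  r + p ∸ 1   ≡⟨ ceilDiv-numerator r q ⟩
  r + q       ≡⟨ +-comm r q ⟩
  q + r       <⟨ +-monoʳ-≤ (suc q) (m≤m*n r p) ⟩
  p + r * p   ∎))
  where open ≤-Reasoning

≤*ceilDiv : ∀ r p .{{_ : NonZero p}} → r ≤ p * ceilDiv r p
≤*ceilDiv r p@(suc q) = subst (r ≤_) (*-comm s p) (+-cancelʳ-≤ q r (s * p) (begin
  r + q                        ≡⟨ ceilDiv-numerator r q ⟨
  r + p ∸ 1                    ≡⟨ m≡m%n+[m/n]*n (r + p ∸ 1) p ⟩
  (r + p ∸ 1) % p + s * p      ≡⟨ +-comm _ (s * p) ⟩
  s * p + (r + p ∸ 1) % p      ≤⟨ +-monoʳ-≤ (s * p) (s≤s⁻¹ (m%n<n (r + p ∸ 1) p)) ⟩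
  s * p + q                    ∎))
  where
  open ≤-Reasoning
  s = ceilDiv r p

VdWProp-mono : ∀ {r k M N} → M ≤ N → VdWProp r k M → VdWProp r k N
VdWProp-mono M≤N vdw c with vdw c
... | a , d , 1≤a , 1≤d , end≤M , mono = a , d , 1≤a , 1≤d , ≤-trans end≤M M≤N , mono

module BlowUp {r s p : ℕ} .{{_ : NonZero p}} (s≤r : s ≤ r) (χ : Colouring (r ∸ s)) where

  shade : ℕ → ℕ
  shade u = skip s (u % p) (toℕ (χ (suc (u / p))))

  shade<r : ∀ u → shade u < r
  shade<r u = skip-< (u % p) s≤r (toℕ<n (χ (suc (u / p))))

  blowUp : Colouring r
  blowUp x = fromℕ< (shade<r (x ∸ 1))

  shade-block : ∀ u m → shade (u + m * p) ≡ skip s (u % p) (toℕ (χ (suc (u / p + m))))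
  shade-block u m = cong₂ (λ j q → skip s j (toℕ (χ (suc q)))) ([m+kn]%n≡m%n u m p) ([m+kn]/n≡m/n+k u m p)

  MonoShade : (k b d : ℕ) → Set
  MonoShade k b d = ∀ i → i < k → shade (b + i * d) ≡ shade b

  monoShade-divisible : ∀ {k N b} e → 1 ≤ e → b + (k ∸ 1) * (e * p) < p * N →
    MonoShade k b (e * p) → HasMonoAP (r ∸ s) k N χ
  monoShade-divisible {k} {N} {b} e 1≤e end<pN mono = suc (b / p) , e , s≤s z≤n , 1≤e , end≤N , mono′
    where
    regroup : ∀ i → b + i * (e * p) ≡ b + i * e * p
    regroup i = cong (b +_) (sym (*-assoc i e p))

    end≤N : suc (b / p) + (k ∸ 1) * e ≤ N
    end≤N = subst (_< N) ([m+kn]/n≡m/n+k b ((k ∸ 1) * e) p)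
      (m<n*o⇒m/o<n (subst₂ _<_ (regroup (k ∸ 1)) (*-comm p N) end<pN))

    mono′ : ∀ i → i < k → χ (suc (b / p) + i * e) ≡ χ (suc (b / p))
    mono′ i i<k = toℕ-injective (skip-injective s (b % p)
      (trans (sym (shade-block b (i * e))) (trans (cong shade (sym (regroup i))) (mono i i<k))))

  monoShade-indivisible : ∀ {k d} .{{_ : NonZero s}} → Prime p → ¬ p ∣ d → p ≤ k → r ≤ p * s →
    ∀ b → ¬ MonoShade k b d
  monoShade-indivisible {d = d} p-prime p∤d p≤k r≤ps b mono
    with residues-cover p-prime p∤d b (m<n*o⇒m/o<n (<-≤-trans (shade<r b) r≤ps))
  ... | i , i<p , residue≡ =
    skip-avoids s (shade b) colour (subst (λ j → skip s j colour ≡ shade b) residue≡ (mono i (<-≤-trans i<p p≤k)))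
    where colour = toℕ (χ (suc ((b + i * d) / p)))

  blowUp-mono⇒monoShade : ∀ {k b d} →
    (∀ i → i < k → blowUp (suc b + i * d) ≡ blowUp (suc b)) → MonoShade k b d
  blowUp-mono⇒monoShade mono i i<k = trans (sym (toℕ-fromℕ< _)) (trans (cong toℕ (mono i i<k)) (toℕ-fromℕ< _))

  blowUp-monoAP : ∀ {k N} .{{_ : NonZero s}} → Prime p → p ≤ k → r ≤ p * s →
    HasMonoAP r k (p * N) blowUp → HasMonoAP (r ∸ s) k N χ
  blowUp-monoAP _ _ _ (zero , _ , () , _)
  blowUp-monoAP p-prime p≤k r≤ps (suc b , d , _ , 1≤d , end≤pN , mono) with p ∣? d
  ... | yes (divides (suc e) refl) =
    monoShade-divisible (suc e) (s≤s z≤n) end≤pN (blowUp-mono⇒monoShade mono)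
  ... | no p∤d = contradiction (blowUp-mono⇒monoShade mono) (monoShade-indivisible p-prime p∤d p≤k r≤ps b)

vdW-fewerColours : ∀ {r k p N} .{{_ : NonZero p}} → Prime p → p ≤ k → 1 ≤ r →
  VdWProp r k (p * N) → VdWProp (r ∸ ceilDiv r p) k N
vdW-fewerColours {r} {p = p} p-prime p≤k 1≤r vdw χ =
  blowUp-monoAP p-prime p≤k (≤*ceilDiv r p) (vdw blowUp)
  where
  instance
    _ : NonZero (ceilDiv r p)
    _ = >-nonZero (ceilDiv>0 r p 1≤r)
  open BlowUp (ceilDiv≤ r p) χ

theorem2 : (r k p W W′ : ℕ) → .{{_ : NonZero p}} → 2 ≤ r → 2 ≤ k →
    IsLargestPrimeLE k p →
    IsVdW r k W → IsVdW (r ∸ ceilDiv r p) k W′ →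
    p * (W′ ∸ 1) < W
theorem2 r k p W zero _ _ _ _ (() , _)
theorem2 r k p W (suc N) 2≤r _ (p-prime , p≤k , _) (1≤W , vdwW , _) (_ , _ , W′-least) = ≰⇒> λ W≤pN →
  let instance
        _ : NonZero (p * N)
        _ = >-nonZero (≤-trans 1≤W W≤pN)
  in 1+n≰n (W′-least N (>-nonZero⁻¹ N {{m*n≢0⇒n≢0 p}})
                       (vdW-fewerColours p-prime p≤k (≤-trans (s≤s z≤n) 2≤r) (VdWProp-mono W≤pN vdwW)))
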